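{- Suppose $0<\epsilon,\delta<\tfrac16$. Let $n\ge m$ and let $P$ be an $\epsilon$-dense $m\times n$ partial latin rectangle on the symbol set $[n]$. Let $A_1,\dots,A_n\subseteq[n]$ satisfy $|A_j|<\delta m$ for each $j$ and $|\{j:k\in A_j\}|<\delta m$ for each $k\in[n]$. Then $P$ is contained in a $3(\delta+\epsilon)$-dense $m\times n$ partial latin rectangle $P'$ such that, for each $j=1,\dots,n$, column $j$ of $P'$ contains all elements of $A_j$.
   Context: An $m\times n$ partial latin rectangle (on symbols $[n]$) is an $m\times n$ array whose cells are empty or contain a symbol of $[n]$, with each symbol appearing at most once in each row and at most once in each column. It is $\epsilon$-dense if every row has at most $\epsilon n$ filled cells, every column has at most $\epsilon m$ filled cells, and every symbol is used at most $\epsilon m$ times. $P\subseteq P'$ means every filled cell of $P$ is filled with the same symbol in $P'$.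
   Formalization: The parameters ε and δ are taken to be rational numbers. -}

module Defs where

open import Data.Nat using (ℕ; zero; suc; _+_)
open import Data.Fin using (Fin; zero; suc; _≟_)
import Data.Vec
open import Data.Bool using (Bool; true; false; if_then_else_)
open import Data.Maybe using (Maybe; just; nothing; is-just)
open import Data.Product using (∃)
open import Relation.Binary.PropositionalEquality using (_≡_)
open import Relation.Nullary.Decidable using (⌊_⌋)
open import Data.Integer using (+_)
open import Data.Rational using (ℚ; _/_; _≤_; _*_)

countF : {k : ℕ} → (Fin k → Bool) → ℕ
countF {zero} f = 0
countF {suc k} f = (if f zero then 1 else 0) + countF (λ x → f (suc x))

ℕ→ℚ : ℕ → ℚ
ℕ→ℚ k = + k / 1

Array : ℕ → ℕ → Set
Array m n = Fin m → Fin n → Maybe (Fin n)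

IsPLR : {m n : ℕ} → Array m n → Set
IsPLR {m} {n} P =
  (∀ (i : Fin m) (j j′ : Fin n) (s : Fin n) → P i j ≡ just s → P i j′ ≡ just s → j ≡ j′) Data.Product.×
  (∀ (i i′ : Fin m) (j : Fin n) (s : Fin n) → P i j ≡ just s → P i′ j ≡ just s → i ≡ i′)

isSym : {n : ℕ} → Fin n → Maybe (Fin n) → Bool
isSym s nothing = false
isSym s (just t) = ⌊ t ≟ s ⌋

rowCount : {m n : ℕ} → Array m n → Fin m → ℕ
rowCount P i = countF (λ j → is-just (P i j))

colCount : {m n : ℕ} → Array m n → Fin n → ℕ
colCount P j = countF (λ i → is-just (P i j))

symCount : {m n : ℕ} → Array m n → Fin n → ℕ
symCount {m} {n} P s = sumF (λ i → countF (λ j → isSym s (P i j)))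
  where
  sumF : {k : ℕ} → (Fin k → ℕ) → ℕ
  sumF {zero} g = 0
  sumF {suc k} g = g zero + sumF (λ x → g (suc x))

Dense : {m n : ℕ} → ℚ → Array m n → Set
Dense {m} {n} ε P =
  (∀ i → ℕ→ℚ (rowCount P i) ≤ ε * ℕ→ℚ n) Data.Product.×
  (∀ j → ℕ→ℚ (colCount P j) ≤ ε * ℕ→ℚ m) Data.Product.×
  (∀ s → ℕ→ℚ (symCount P s) ≤ ε * ℕ→ℚ m)

_⊑_ : {m n : ℕ} → Array m n → Array m n → Set
P ⊑ P′ = ∀ i j s → P i j ≡ just s → P′ i j ≡ just s

occurrences : {n : ℕ} → (Fin n → Data.Vec.Vec Bool n) → Fin n → ℕ
occurrences A k = countF (λ j → Data.Vec.lookup (A j) k)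

{-# OPTIONS --safe #-}
-- Greedy completion. Let s be the largest of the column loads colCount P j + |A j| and
-- symbol loads symCount P k + |{j : k ∈ A j}|; then s < (δ + ε)m, so 3s < m. Serve the
-- demands "k in column j" one at a time, always keeping enough capacity reserved that
-- every column and every symbol ends with at most s entries. An unserved demand (j, k)
-- is placed in a row that is empty at j, does not contain k, and would still have at
-- most 3sn/m entries. Such a row exists: column j and symbol k exclude fewer than 2s
-- rows, so otherwise at least m − 2s + 2 rows would be full, and they would carry more
-- entries than the fewer than ns allowed by the column capacities. Rows therefore end
-- with at most max(εn, 3sn/m) ≤ 3(δ + ε)n entries.
module Submission where

open import Defs

module Counting where
  open import Data.Nat
  open import Data.Nat.Properties
  open import Data.Bool using (Bool; true; false; if_then_else_)
  open import Data.Fin using (Fin; zero; suc; punchIn)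
  open import Data.Fin.Properties using (punchInᵢ≢i)
  open import Data.Fin.Subset using (Subset; ∣_∣)
  open import Data.Vec using ([]; _∷_; lookup)
  open import Data.Vec.Functional using (removeAt)
  open import Data.Product using (∃; _,_)
  open import Data.Sum using (inj₁; inj₂)
  open import Function using (_∘_)
  open import Relation.Binary.PropositionalEquality
  open import Algebra.Properties.Semiring.Sum +-*-semiring using (sum; sum-cong-≗; sum-remove)

  indicator : Bool → ℕ
  indicator b = if b then 1 else 0

  countF≡sum : ∀ {k} (f : Fin k → Bool) → countF f ≡ sum (indicator ∘ f)
  countF≡sum {zero}  f = refl
  countF≡sum {suc k} f = cong (indicator (f zero) +_) (countF≡sum (f ∘ suc))

  sum-mono-≤ : ∀ {k} {f g : Fin k → ℕ} → (∀ x → f x ≤ g x) → sum f ≤ sum g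
  sum-mono-≤ {zero}  f≤g = z≤n
  sum-mono-≤ {suc k} f≤g = +-mono-≤ (f≤g zero) (sum-mono-≤ (f≤g ∘ suc))

  sum-const : ∀ k c → sum {k} (λ _ → c) ≡ k * c
  sum-const zero    c = refl
  sum-const (suc k) c = cong (c +_) (sum-const k c)

  term≤sum : ∀ {k} (f : Fin k → ℕ) x → f x ≤ sum f
  term≤sum {suc k} f x = ≤-trans (m≤m+n (f x) _) (≤-reflexive (sym (sum-remove {i = x} f)))

  sum-increment : ∀ {k} {f g : Fin k → ℕ} x → g x ≡ suc (f x) → (∀ y → y ≢ x → g y ≡ f y) →
    sum g ≡ suc (sum f)
  sum-increment {suc k} {f} {g} x gx≡ g≡f = begin
    sum g                               ≡⟨ sum-remove {i = x} g ⟩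
    g x + sum (removeAt g x)            ≡⟨ cong₂ _+_ gx≡ (sum-cong-≗ λ y → g≡f (punchIn x y) (punchInᵢ≢i x y)) ⟩
    suc (f x + sum (removeAt f x))      ≡⟨ cong suc (sum-remove {i = x} f) ⟨
    suc (sum f)                         ∎
    where open ≡-Reasoning

  countF-cong : ∀ {k} {f g : Fin k → Bool} → (∀ x → f x ≡ g x) → countF f ≡ countF g
  countF-cong {f = f} {g} f≡g = begin
    countF f                 ≡⟨ countF≡sum f ⟩
    sum (indicator ∘ f)      ≡⟨ sum-cong-≗ (cong indicator ∘ f≡g) ⟩
    sum (indicator ∘ g)      ≡⟨ countF≡sum g ⟨
    countF g                 ∎
    where open ≡-Reasoning

  countF-mono : ∀ {k} {f g : Fin k → Bool} → (∀ x → f x ≡ true → g x ≡ true) → countF f ≤ countF g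
  countF-mono {f = f} {g} f⊆g = begin
    countF f                 ≡⟨ countF≡sum f ⟩
    sum (indicator ∘ f)      ≤⟨ sum-mono-≤ pointwise ⟩
    sum (indicator ∘ g)      ≡⟨ countF≡sum g ⟨
    countF g                 ∎
    where
    open ≤-Reasoning
    pointwise : ∀ x → indicator (f x) ≤ indicator (g x)
    pointwise x with f x in fx
    ... | false = z≤n
    ... | true  rewrite f⊆g x fx = ≤-refl

  countF-pos : ∀ {k} (f : Fin k → Bool) x → f x ≡ true → 0 < countF f
  countF-pos f x fx = begin-strict
    0                        <⟨ ≤-reflexive (cong indicator (sym fx)) ⟩
    indicator (f x)          ≤⟨ term≤sum (indicator ∘ f) x ⟩
    sum (indicator ∘ f)      ≡⟨ countF≡sum f ⟨
    countF f                 ∎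
    where open ≤-Reasoning

  countF-insert : ∀ {k} {f g : Fin k → Bool} x → f x ≡ false → g x ≡ true →
    (∀ y → y ≢ x → g y ≡ f y) → countF g ≡ suc (countF f)
  countF-insert {f = f} {g} x fx gx g≡f = begin
    countF g                 ≡⟨ countF≡sum g ⟩
    sum (indicator ∘ g)      ≡⟨ sum-increment x (trans (cong indicator gx) (cong (suc ∘ indicator) (sym fx)))
                                  (λ y y≢x → cong indicator (g≡f y y≢x)) ⟩
    suc (sum (indicator ∘ f)) ≡⟨ cong suc (countF≡sum f) ⟨
    suc (countF f)           ∎
    where open ≡-Reasoning

  countF≤ : ∀ {k} (f : Fin k → Bool) → countF f ≤ k
  countF≤ {zero}  f = z≤n
  countF≤ {suc k} f with f zero
  ... | true  = s≤s (countF≤ (f ∘ suc))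
  ... | false = m≤n⇒m≤1+n (countF≤ (f ∘ suc))

  ∣p∣≡countF : ∀ {k} (p : Subset k) → ∣ p ∣ ≡ countF (lookup p)
  ∣p∣≡countF []          = refl
  ∣p∣≡countF (true ∷ p)  = cong suc (∣p∣≡countF p)
  ∣p∣≡countF (false ∷ p) = ∣p∣≡countF p

  maxF : ∀ {k} → (Fin (suc k) → ℕ) → ℕ
  maxF {zero}  f = f zero
  maxF {suc k} f = f zero ⊔ maxF (f ∘ suc)

  f≤maxF : ∀ {k} (f : Fin (suc k) → ℕ) x → f x ≤ maxF f
  f≤maxF {zero}  f zero    = ≤-refl
  f≤maxF {suc k} f zero    = m≤m⊔n _ _
  f≤maxF {suc k} f (suc x) = ≤-trans (f≤maxF (f ∘ suc) x) (m≤n⊔m _ _)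

  maxF-attained : ∀ {k} (f : Fin (suc k) → ℕ) → ∃ λ x → maxF f ≡ f x
  maxF-attained {zero}  f = zero , refl
  maxF-attained {suc k} f with ⊔-sel (f zero) (maxF (f ∘ suc))
  ... | inj₁ at-zero = zero , at-zero
  ... | inj₂ in-tail = let x , attained = maxF-attained (f ∘ suc) in suc x , trans in-tail attained

module Extension where
  open import Data.Nat hiding (_≟_)
  open import Data.Nat.Properties hiding (_≟_)
  open import Data.Bool using (Bool; true; false)
  import Data.Bool.Properties as Bool
  open import Data.Fin using (Fin; zero; suc; _≟_)
  open import Data.Fin.Properties using (any?; all?)
  open import Data.Maybe using (Maybe; just; nothing; is-just)
  import Data.Maybe.Properties as Maybe
  open import Data.Product using (∃; ∃₂; _×_; _,_; proj₂)
  open import Data.Sum using (_⊎_; inj₁; inj₂)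
  open import Data.Empty using (⊥; ⊥-elim)
  open import Function using (_∘_; id)
  open import Relation.Nullary using (Dec; yes; no; does; ¬_; contradiction)
  open import Relation.Nullary.Decidable using (_×-dec_; ¬?)
  open import Relation.Binary.PropositionalEquality
  open import Algebra.Properties.Semiring.Sum +-*-semiring using (sum; sum-cong-≗; ∑-comm; ∑-distrib-+; *-distribʳ-sum)
  open import Data.Nat.Tactic.RingSolver using (solve)
  open import Data.List using ([]; _∷_)
  open Counting

  Demands : ℕ → Set
  Demands n = Fin n → Fin n → Bool

  infixl 6 _[_,_]≔_
  _[_,_]≔_ : ∀ {a b} {X : Set} → (Fin a → Fin b → X) → Fin a → Fin b → X → Fin a → Fin b → X
  (F [ i , j ]≔ x) i′ j′ with i′ ≟ i | j′ ≟ j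
  ... | yes _ | yes _ = x
  ... | _     | _     = F i′ j′

  data Position {a b} (i : Fin a) (j : Fin b) : Fin a → Fin b → Set where
    at  : Position i j i j
    off : ∀ {i′ j′} → i′ ≢ i ⊎ j′ ≢ j → Position i j i′ j′

  position : ∀ {a b} (i : Fin a) (j : Fin b) i′ j′ → Position i j i′ j′
  position i j i′ j′ with i′ ≟ i | j′ ≟ j
  ... | yes refl | yes refl = at
  ... | no i′≢i  | _        = off (inj₁ i′≢i)
  ... | yes _    | no j′≢j  = off (inj₂ j′≢j)

  ≔-at : ∀ {a b} {X : Set} (F : Fin a → Fin b → X) i j x → (F [ i , j ]≔ x) i j ≡ x
  ≔-at F i j x with i ≟ i | j ≟ j
  ... | yes _   | yes _   = refl
  ... | no i≢i  | _       = contradiction refl i≢i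
  ... | yes _   | no j≢j  = contradiction refl j≢j

  -- The indices are explicit: Agda cannot recover them from an update defined by 'with'.
  ≔-off : ∀ {a b} {X : Set} (F : Fin a → Fin b → X) i j x i′ j′ → i′ ≢ i ⊎ j′ ≢ j →
    (F [ i , j ]≔ x) i′ j′ ≡ F i′ j′
  ≔-off F i j x i′ j′ elsewhere with i′ ≟ i | j′ ≟ j | elsewhere
  ... | yes i′≡i | yes j′≡j | inj₁ i′≢i = contradiction i′≡i i′≢i
  ... | yes i′≡i | yes j′≡j | inj₂ j′≢j = contradiction j′≡j j′≢j
  ... | yes _    | no _     | _         = refl
  ... | no _     | _        | _         = refl

  isSym-self : ∀ {n} (k : Fin n) → isSym k (just k) ≡ true
  isSym-self k with k ≟ k
  ... | yes _   = refl
  ... | no k≢k  = contradiction refl k≢k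

  isSym-other : ∀ {n} {k k′ : Fin n} → k′ ≢ k → isSym k′ (just k) ≡ false
  isSym-other {k = k} {k′} k′≢k with k ≟ k′
  ... | yes k≡k′ = contradiction (sym k≡k′) k′≢k
  ... | no _     = refl

  symCount≡sum : ∀ {m n} (Q : Array m n) k → symCount Q k ≡ sum (λ i → countF (λ j → isSym k (Q i j)))
  symCount≡sum {zero}  Q k = refl
  symCount≡sum {suc m} Q k = cong (countF (λ j → isSym k (Q zero j)) +_) (symCount≡sum (Q ∘ suc) k)

  sum-rowCount≡sum-colCount : ∀ {m n} (Q : Array m n) → sum (rowCount Q) ≡ sum (colCount Q)
  sum-rowCount≡sum-colCount Q = begin
    sum (rowCount Q)                                       ≡⟨ sum-cong-≗ (λ i → countF≡sum (is-just ∘ Q i)) ⟩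
    sum (λ i → sum (λ j → indicator (is-just (Q i j))))    ≡⟨ ∑-comm (λ i j → indicator (is-just (Q i j))) ⟩
    sum (λ j → sum (λ i → indicator (is-just (Q i j))))    ≡⟨ sum-cong-≗ (λ j → countF≡sum (λ i → is-just (Q i j))) ⟨
    sum (colCount Q)                                       ∎
    where open ≡-Reasoning

  module _ {m n} (Q : Array m n) (i : Fin m) (j k : Fin n) where

    rowCount-≔-other : ∀ {i′} → i′ ≢ i → rowCount (Q [ i , j ]≔ just k) i′ ≡ rowCount Q i′
    rowCount-≔-other {i′} i′≢i = countF-cong (λ j′ → cong is-just (≔-off Q i j (just k) i′ j′ (inj₁ i′≢i)))

    colCount-≔-other : ∀ {j′} → j′ ≢ j → colCount (Q [ i , j ]≔ just k) j′ ≡ colCount Q j′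
    colCount-≔-other {j′} j′≢j = countF-cong (λ i′ → cong is-just (≔-off Q i j (just k) i′ j′ (inj₂ j′≢j)))

    module _ (empty : Q i j ≡ nothing) where

      ≔-extends : Q ⊑ (Q [ i , j ]≔ just k)
      ≔-extends i′ j′ t e with position i j i′ j′
      ... | at       = contradiction (trans (sym empty) e) λ ()
      ... | off away = trans (≔-off Q i j (just k) i′ j′ away) e

      rowCount-≔ : rowCount (Q [ i , j ]≔ just k) i ≡ suc (rowCount Q i)
      rowCount-≔ = countF-insert j (cong is-just empty) (cong is-just (≔-at Q i j (just k)))
        (λ j′ j′≢j → cong is-just (≔-off Q i j (just k) i j′ (inj₂ j′≢j)))

      colCount-≔ : colCount (Q [ i , j ]≔ just k) j ≡ suc (colCount Q j)
      colCount-≔ = countF-insert i (cong is-just empty) (cong is-just (≔-at Q i j (just k)))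
        (λ i′ i′≢i → cong is-just (≔-off Q i j (just k) i′ j (inj₁ i′≢i)))

      symCount-≔ : symCount (Q [ i , j ]≔ just k) k ≡ suc (symCount Q k)
      symCount-≔ = begin
        symCount (Q [ i , j ]≔ just k) k  ≡⟨ symCount≡sum (Q [ i , j ]≔ just k) k ⟩
        sum (λ i′ → countF (λ j′ → isSym k ((Q [ i , j ]≔ just k) i′ j′)))
          ≡⟨ sum-increment i
               (countF-insert j (cong (isSym k) empty) (trans (cong (isSym k) (≔-at Q i j (just k))) (isSym-self k))
                 (λ j′ j′≢j → cong (isSym k) (≔-off Q i j (just k) i j′ (inj₂ j′≢j))))
               (λ i′ i′≢i → countF-cong (λ j′ → cong (isSym k) (≔-off Q i j (just k) i′ j′ (inj₁ i′≢i)))) ⟩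
        suc (sum (λ i′ → countF (λ j′ → isSym k (Q i′ j′))))  ≡⟨ cong suc (symCount≡sum Q k) ⟨
        suc (symCount Q k)                ∎
        where open ≡-Reasoning

      symCount-≔-other : ∀ {k′} → k′ ≢ k → symCount (Q [ i , j ]≔ just k) k′ ≡ symCount Q k′
      symCount-≔-other {k′} k′≢k = begin
        symCount (Q [ i , j ]≔ just k) k′ ≡⟨ symCount≡sum (Q [ i , j ]≔ just k) k′ ⟩
        sum (λ i′ → countF (λ j′ → isSym k′ ((Q [ i , j ]≔ just k) i′ j′)))
          ≡⟨ sum-cong-≗ (λ i′ → countF-cong (λ j′ → unchanged i′ j′)) ⟩
        sum (λ i′ → countF (λ j′ → isSym k′ (Q i′ j′))) ≡⟨ symCount≡sum Q k′ ⟨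
        symCount Q k′                     ∎
        where
        open ≡-Reasoning
        unchanged : ∀ i′ j′ → isSym k′ ((Q [ i , j ]≔ just k) i′ j′) ≡ isSym k′ (Q i′ j′)
        unchanged i′ j′ with position i j i′ j′
        ... | at       = trans (cong (isSym k′) (≔-at Q i j (just k)))
                               (trans (isSym-other k′≢k) (cong (isSym k′) (sym empty)))
        ... | off away = cong (isSym k′) (≔-off Q i j (just k) i′ j′ away)

  ≔-entry : ∀ {m n} (Q : Array m n) i j k i′ j′ {t} → (Q [ i , j ]≔ just k) i′ j′ ≡ just t →
    (i′ ≡ i × j′ ≡ j × t ≡ k) ⊎ Q i′ j′ ≡ just t
  ≔-entry Q i j k i′ j′ e with position i j i′ j′
  ... | at       = inj₁ (refl , refl , Maybe.just-injective (trans (sym e) (≔-at Q i j (just k))))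
  ... | off away = inj₂ (trans (sym (≔-off Q i j (just k) i′ j′ away)) e)

  ≔-isPLR : ∀ {m n} {Q : Array m n} {i j k} → IsPLR Q →
    (∀ j′ → Q i j′ ≢ just k) → (∀ i′ → Q i′ j ≢ just k) → IsPLR (Q [ i , j ]≔ just k)
  ≔-isPLR {Q = Q} {i} {j} {k} (rowsPLR , colsPLR) fresh-in-row fresh-in-col = rows′ , cols′
    where
    rows′ : ∀ i₀ j₁ j₂ t → (Q [ i , j ]≔ just k) i₀ j₁ ≡ just t → (Q [ i , j ]≔ just k) i₀ j₂ ≡ just t → j₁ ≡ j₂
    rows′ i₀ j₁ j₂ t e₁ e₂ with ≔-entry Q i j k i₀ j₁ e₁ | ≔-entry Q i j k i₀ j₂ e₂
    ... | inj₁ (_ , refl , _)    | inj₁ (_ , refl , _)    = refl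
    ... | inj₁ (refl , _ , refl) | inj₂ e                 = contradiction e (fresh-in-row j₂)
    ... | inj₂ e                 | inj₁ (refl , _ , refl) = contradiction e (fresh-in-row j₁)
    ... | inj₂ e                 | inj₂ e′                = rowsPLR i₀ j₁ j₂ t e e′
    cols′ : ∀ i₁ i₂ j₀ t → (Q [ i , j ]≔ just k) i₁ j₀ ≡ just t → (Q [ i , j ]≔ just k) i₂ j₀ ≡ just t → i₁ ≡ i₂
    cols′ i₁ i₂ j₀ t e₁ e₂ with ≔-entry Q i j k i₁ j₀ e₁ | ≔-entry Q i j k i₂ j₀ e₂
    ... | inj₁ (refl , _ , _)    | inj₁ (refl , _ , _)    = refl
    ... | inj₁ (_ , refl , refl) | inj₂ e                 = contradiction e (fresh-in-col i₂)
    ... | inj₂ e                 | inj₁ (_ , refl , refl) = contradiction e (fresh-in-col i₁)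
    ... | inj₂ e                 | inj₂ e′                = colsPLR i₁ i₂ j₀ t e e′

  module _ {n} (W : Demands n) (j k : Fin n) where

    ≔false-⊆ : ∀ j′ k′ → (W [ j , k ]≔ false) j′ k′ ≡ true → W j′ k′ ≡ true
    ≔false-⊆ j′ k′ e with position j k j′ k′
    ... | at       = contradiction (trans (sym e) (≔-at W j k false)) λ ()
    ... | off away = trans (sym (≔-off W j k false j′ k′ away)) e

    module _ (pending : W j k ≡ true) where

      row-≔false : countF (W j) ≡ suc (countF ((W [ j , k ]≔ false) j))
      row-≔false = countF-insert k (≔-at W j k false) pending
        (λ k′ k′≢k → sym (≔-off W j k false j k′ (inj₂ k′≢k)))

      col-≔false : countF (λ j′ → W j′ k) ≡ suc (countF (λ j′ → (W [ j , k ]≔ false) j′ k))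
      col-≔false = countF-insert j (≔-at W j k false) pending
        (λ j′ j′≢j → sym (≔-off W j k false j′ k (inj₁ j′≢j)))

      total-≔false : sum (countF ∘ W) ≡ suc (sum (countF ∘ (W [ j , k ]≔ false)))
      total-≔false = sum-increment j row-≔false
        (λ j′ j′≢j → countF-cong (λ k′ → sym (≔-off W j k false j′ k′ (inj₁ j′≢j))))

  fin-cases : ∀ {a} (P : Fin a → Set) {y} → P y → (∀ {x} → x ≢ y → P x) → ∀ x → P x
  fin-cases P {y} at-y elsewhere x with x ≟ y
  ... | yes refl = at-y
  ... | no x≢y   = elsewhere x≢y

  +-exchange-suc : ∀ {a a′ b b′} → a′ ≡ suc a → b ≡ suc b′ → a′ + b′ ≡ a + b
  +-exchange-suc {a} {b′ = b′} refl refl = sym (+-suc a b′)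

  full-rows-lower-bound : ∀ {s m C S F} → 3 * s < m → m ≤ C + S + F → C < s → S < s →
    m + s * m ≤ 3 * s * F
  -- With s = 1 + w and m = 3s + 1 + u, the slack 5w + 4 + (2w + 1)u is exactly 3s(m + 2) − (m + sm + 6s²).
  full-rows-lower-bound {s@(suc w)} {m} {C} {S} {F} 3s<m m≤C+S+F C<s S<s
    with m≤n⇒∃[o]m+o≡n 3s<m
  ... | u , refl = +-cancelʳ-≤ (3 * s * (2 * s)) (m + s * m) (3 * s * F) (begin
      m + s * m + 3 * s * (2 * s)                                   ≤⟨ m≤m+n _ (5 * w + 4 + (2 * w + 1) * u) ⟩
      m + s * m + 3 * s * (2 * s) + (5 * w + 4 + (2 * w + 1) * u)   ≡⟨ solve (w ∷ u ∷ []) ⟩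
      3 * s * (m + 2)                                               ≤⟨ *-monoʳ-≤ (3 * s) m+2≤F+2s ⟩
      3 * s * (F + 2 * s)                                           ≡⟨ *-distribˡ-+ (3 * s) F (2 * s) ⟩
      3 * s * F + 3 * s * (2 * s)                                   ∎)
    where
    open ≤-Reasoning
    m+2≤F+2s : m + 2 ≤ F + 2 * s
    m+2≤F+2s = begin
      m + 2               ≤⟨ +-monoˡ-≤ 2 m≤C+S+F ⟩
      C + S + F + 2       ≡⟨ solve (C ∷ S ∷ F ∷ []) ⟩
      suc C + suc S + F   ≤⟨ +-monoˡ-≤ F (+-mono-≤ C<s S<s) ⟩
      suc w + suc w + F   ≡⟨ solve (w ∷ F ∷ []) ⟩
      F + 2 * s           ∎

  full-rows-too-many : ∀ {s m n F R} → 0 < m → m ≤ n → F ≤ m → m + s * m ≤ 3 * s * F →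
    F * suc (3 * s * n) ≤ (F + R) * m → R < n * s → ⊥
  full-rows-too-many {s} {m@(suc m′)} {n} {F} {R} _ m≤n F≤m m+sm≤3sF weight R<ns =
    m+1+n≰m (F * suc (3 * s * n)) (begin
      F * suc (3 * s * n) + m       ≤⟨ +-monoˡ-≤ m weight ⟩
      (F + R) * m + m               ≡⟨ solve (F ∷ R ∷ m′ ∷ []) ⟩
      F * m + suc R * m             ≤⟨ +-mono-≤ (*-monoˡ-≤ m F≤m) (*-monoˡ-≤ m R<ns) ⟩
      m * m + n * s * m             ≤⟨ +-monoˡ-≤ (n * s * m) (*-monoˡ-≤ m m≤n) ⟩
      n * m + n * s * m             ≡⟨ solve (n ∷ s ∷ m′ ∷ []) ⟩
      n * (m + s * m)               ≤⟨ *-monoʳ-≤ n m+sm≤3sF ⟩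
      n * (3 * s * F)               ≡⟨ solve (n ∷ s ∷ F ∷ []) ⟩
      F * (3 * s * n)               ≤⟨ *-monoʳ-≤ F (n≤1+n _) ⟩
      F * suc (3 * s * n)           ∎)
    where open ≤-Reasoning

  RowBound : ∀ {m n} → ℕ → Array m n → Array m n → Fin m → Set
  RowBound {m} {n} s P Q i = rowCount Q i ≤ rowCount P i ⊎ rowCount Q i * m ≤ 3 * s * n

  record Completion {m n} (s : ℕ) (P : Array m n) (A : Demands n) : Set where
    field
      array   : Array m n
      isPLR   : IsPLR array
      extends : P ⊑ array
      rows    : ∀ i → RowBound s P array i
      cols    : ∀ j → colCount array j ≤ s
      syms    : ∀ k → symCount array k ≤ s
      covers  : ∀ j k → A j k ≡ true → ∃ λ i → array i j ≡ just k

  module Greedy {m n} (s : ℕ) (P : Array m n) (A : Demands n) where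

    Covers : Array m n → Demands n → Set
    Covers Q W = ∀ j k → A j k ≡ true → W j k ≡ true ⊎ ∃ λ i → Q i j ≡ just k

    record Invariant (Q : Array m n) (W : Demands n) : Set where
      field
        isPLR   : IsPLR Q
        extends : P ⊑ Q
        rows    : ∀ i → RowBound s P Q i
        cols    : ∀ j → colCount Q j + countF (W j) ≤ s
        syms    : ∀ k → symCount Q k + countF (λ j → W j k) ≤ s
        covers  : Covers Q W

    Admissible : Array m n → Fin n → Fin n → Fin m → Set
    Admissible Q j k i = Q i j ≡ nothing × (∀ j′ → Q i j′ ≢ just k) × suc (rowCount Q i) * m ≤ 3 * s * n

    _≟ₘ_ : (x y : Maybe (Fin n)) → Dec (x ≡ y)
    _≟ₘ_ = Maybe.≡-dec _≟_

    admissible? : ∀ Q j k i → Dec (Admissible Q j k i)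
    admissible? Q j k i =
      Q i j ≟ₘ nothing ×-dec all? (λ j′ → ¬? (Q i j′ ≟ₘ just k)) ×-dec suc (rowCount Q i) * m ≤? 3 * s * n

    covers-≔false : ∀ {Q Q′ W j k} → Q ⊑ Q′ → (∃ λ i → Q′ i j ≡ just k) → Covers Q W →
      Covers Q′ (W [ j , k ]≔ false)
    covers-≔false {W = W} {j} {k} Q⊑Q′ (i , placed) covers j′ k′ demanded with position j k j′ k′
    ... | at       = inj₂ (i , placed)
    ... | off away with covers j′ k′ demanded
    ...   | inj₁ pending        = inj₁ (trans (≔-off W j k false j′ k′ away) pending)
    ...   | inj₂ (i′ , present) = inj₂ (i′ , Q⊑Q′ i′ j′ k′ present)

    discharge : ∀ {Q W j k i} → Invariant Q W → Q i j ≡ just k → Invariant Q (W [ j , k ]≔ false)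
    discharge {Q} {W} {j} {k} {i} inv present = record
      { isPLR   = isPLR
      ; extends = extends
      ; rows    = rows
      ; cols    = λ j′ → ≤-trans (+-monoʳ-≤ (colCount Q j′) (countF-mono (≔false-⊆ W j k j′))) (cols j′)
      ; syms    = λ k′ → ≤-trans (+-monoʳ-≤ (symCount Q k′) (countF-mono (λ j′ → ≔false-⊆ W j k j′ k′))) (syms k′)
      ; covers  = covers-≔false (λ _ _ _ → id) (i , present) covers
      }
      where open Invariant inv

    place : ∀ {Q W j k i} → Invariant Q W → W j k ≡ true → (∀ i′ → Q i′ j ≢ just k) → Admissible Q j k i →
      Invariant (Q [ i , j ]≔ just k) (W [ j , k ]≔ false)
    place {Q} {W} {j} {k} {i} inv pending fresh-in-col (empty , fresh-in-row , room) = record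
      { isPLR   = ≔-isPLR isPLR fresh-in-row fresh-in-col
      ; extends = λ i′ j′ t → ≔-extends Q i j k empty i′ j′ t ∘ extends i′ j′ t
      ; rows    = rows′
      ; cols    = cols′
      ; syms    = syms′
      ; covers  = covers-≔false (≔-extends Q i j k empty) (i , ≔-at Q i j (just k)) covers
      }
      where
      open Invariant inv
      Q′ = Q [ i , j ]≔ just k
      W′ = W [ j , k ]≔ false
      rows′ : ∀ i′ → RowBound s P Q′ i′
      rows′ = fin-cases (RowBound s P Q′)
        (inj₂ (subst (λ r → r * m ≤ 3 * s * n) (sym (rowCount-≔ Q i j k empty)) room))
        (λ {i′} i′≢i → subst (λ r → r ≤ rowCount P i′ ⊎ r * m ≤ 3 * s * n) (sym (rowCount-≔-other Q i j k i′≢i)) (rows i′))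
      cols′ : ∀ j′ → colCount Q′ j′ + countF (W′ j′) ≤ s
      cols′ = fin-cases (λ j′ → colCount Q′ j′ + countF (W′ j′) ≤ s)
        (≤-trans (≤-reflexive (+-exchange-suc (colCount-≔ Q i j k empty) (row-≔false W j k pending))) (cols j))
        (λ {j′} j′≢j → ≤-trans (+-mono-≤ (≤-reflexive (colCount-≔-other Q i j k j′≢j)) (countF-mono (≔false-⊆ W j k j′))) (cols j′))
      syms′ : ∀ k′ → symCount Q′ k′ + countF (λ j′ → W′ j′ k′) ≤ s
      syms′ = fin-cases (λ k′ → symCount Q′ k′ + countF (λ j′ → W′ j′ k′) ≤ s)
        (≤-trans (≤-reflexive (+-exchange-suc (symCount-≔ Q i j k empty) (col-≔false W j k pending))) (syms k))
        (λ {k′} k′≢k → ≤-trans (+-mono-≤ (≤-reflexive (symCount-≔-other Q i j k empty k′≢k)) (countF-mono (λ j′ → ≔false-⊆ W j k j′ k′))) (syms k′))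

    full? : ∀ (Q : Array m n) i → Dec (3 * s * n < suc (rowCount Q i) * m)
    full? Q i = 3 * s * n <? suc (rowCount Q i) * m

    fullRows : Array m n → ℕ
    fullRows Q = countF (λ i → does (full? Q i))

    rows-blocked : ∀ {Q j k} → (∀ i → ¬ Admissible Q j k i) → m ≤ colCount Q j + symCount Q k + fullRows Q
    rows-blocked {Q} {j} {k} none = begin
      m                                          ≡⟨ trans (sum-const m 1) (*-identityʳ m) ⟨
      sum {m} (λ _ → 1)                          ≤⟨ sum-mono-≤ blocked ⟩
      sum (λ i → filled i + holds-k i + full i)  ≡⟨ ∑-distrib-+ (λ i → filled i + holds-k i) full ⟩
      sum (λ i → filled i + holds-k i) + sum full ≡⟨ cong (_+ sum full) (∑-distrib-+ filled holds-k) ⟩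
      sum filled + sum holds-k + sum full        ≡⟨ cong₂ _+_ (cong₂ _+_ (countF≡sum (λ i → is-just (Q i j))) (symCount≡sum Q k)) (countF≡sum (λ i → does (full? Q i))) ⟨
      colCount Q j + symCount Q k + fullRows Q   ∎
      where
      open ≤-Reasoning
      filled holds-k full : Fin m → ℕ
      filled i  = indicator (is-just (Q i j))
      holds-k i = countF (λ j′ → isSym k (Q i j′))
      full i    = indicator (does (full? Q i))
      blocked : ∀ i → 1 ≤ filled i + holds-k i + full i
      blocked i = blocked-by i (full? Q i)
        where
        blocked-by : ∀ i (d : Dec (3 * s * n < suc (rowCount Q i) * m)) → 1 ≤ filled i + holds-k i + indicator (does d)
        blocked-by i (yes _)     = m≤n+m 1 _
        blocked-by i (no roomy) with Q i j in empty
        ... | just _  = s≤s z≤n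
        ... | nothing with any? (λ j′ → Q i j′ ≟ₘ just k)
        ...   | yes (j′ , present) = ≤-trans (countF-pos _ j′ (trans (cong (isSym k) present) (isSym-self k))) (m≤m+n _ 0)
        ...   | no absent          = contradiction (empty , (λ j′ present → absent (j′ , present)) , ≮⇒≥ roomy) (none i)

    full-rows-weight : ∀ (Q : Array m n) → fullRows Q * suc (3 * s * n) ≤ (fullRows Q + sum (rowCount Q)) * m
    full-rows-weight Q = begin
      fullRows Q * K                                   ≡⟨ cong (_* K) (countF≡sum (λ i → does (full? Q i))) ⟩
      sum full * K                                     ≡⟨ *-distribʳ-sum K full ⟩
      sum (λ i → full i * K)                           ≤⟨ sum-mono-≤ (λ i → weight (rowCount Q i) (full? Q i)) ⟩
      sum (λ i → (full i + rowCount Q i) * m)          ≡⟨ *-distribʳ-sum m (λ i → full i + rowCount Q i) ⟨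
      sum (λ i → full i + rowCount Q i) * m            ≡⟨ cong (_* m) (∑-distrib-+ full (rowCount Q)) ⟩
      (sum full + sum (rowCount Q)) * m                ≡⟨ cong (λ x → (x + sum (rowCount Q)) * m) (countF≡sum (λ i → does (full? Q i))) ⟨
      (fullRows Q + sum (rowCount Q)) * m              ∎
      where
      open ≤-Reasoning
      K : ℕ
      K = suc (3 * s * n)
      full : Fin m → ℕ
      full i = indicator (does (full? Q i))
      weight : ∀ r (d : Dec (3 * s * n < suc r * m)) → indicator (does d) * K ≤ (indicator (does d) + r) * m
      weight r (yes crowded) = ≤-trans (≤-reflexive (*-identityˡ K)) crowded
      weight r (no _)        = z≤n

    filled<ns : ∀ {Q W j k} → Invariant Q W → W j k ≡ true → sum (rowCount Q) < n * s
    filled<ns {Q} {W} {j} {k} inv pending = begin-strict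
      sum (rowCount Q)                                ≡⟨ sum-rowCount≡sum-colCount Q ⟩
      sum (colCount Q)                                <⟨ m<m+n _ (<-≤-trans (countF-pos (W j) k pending) (term≤sum (countF ∘ W) j)) ⟩
      sum (colCount Q) + sum (countF ∘ W)             ≡⟨ ∑-distrib-+ (colCount Q) (countF ∘ W) ⟨
      sum (λ j′ → colCount Q j′ + countF (W j′))      ≤⟨ sum-mono-≤ cols ⟩
      sum {n} (λ _ → s)                               ≡⟨ sum-const n s ⟩
      n * s                                           ∎
      where
      open ≤-Reasoning
      open Invariant inv

    module _ (3s<m : 3 * s < m) (m≤n : m ≤ n) where

      admissible-row : ∀ {Q W j k} → Invariant Q W → W j k ≡ true → ∃ (Admissible Q j k)
      admissible-row {Q} {W} {j} {k} inv pending with any? (admissible? Q j k)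
      ... | yes found = found
      ... | no none   = ⊥-elim (full-rows-too-many 0<m m≤n (countF≤ _) m+sm≤3sF (full-rows-weight Q) (filled<ns inv pending))
        where
        open Invariant inv
        0<m : 0 < m
        0<m = ≤-trans (s≤s z≤n) 3s<m
        m+sm≤3sF : m + s * m ≤ 3 * s * fullRows Q
        m+sm≤3sF = full-rows-lower-bound 3s<m (rows-blocked (λ i admissible → none (i , admissible)))
          (<-≤-trans (m<m+n _ (countF-pos (W j) k pending)) (cols j))
          (<-≤-trans (m<m+n _ (countF-pos (λ j′ → W j′ k) j pending)) (syms k))

      serve : ∀ {Q W j k} → Invariant Q W → W j k ≡ true → ∃ λ Q′ → Invariant Q′ (W [ j , k ]≔ false)
      serve {Q} {W} {j} {k} inv pending with any? (λ i → Q i j ≟ₘ just k)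
      ... | yes (i , present) = Q , discharge inv present
      ... | no absent with admissible-row inv pending
      ...   | i , admissible = Q [ i , j ]≔ just k , place inv pending (λ i′ present → absent (i′ , present)) admissible

      some-pending : (W : Demands n) → (∃₂ λ j k → W j k ≡ true) ⊎ (∀ j k → W j k ≡ false)
      some-pending W with any? (λ j → any? (λ k → W j k Bool.≟ true))
      ... | yes (j , k , pending) = inj₁ (j , k , pending)
      ... | no none               = inj₂ (λ j k → Bool.¬-not (λ pending → none (j , k , pending)))

      finish : ∀ {Q W} → Invariant Q W → (∀ j k → W j k ≡ false) → Completion s P A
      finish {Q} {W} inv none = record
        { array = Q ; isPLR = isPLR ; extends = extends ; rows = rows
        ; cols = λ j → m+n≤o⇒m≤o _ (cols j)
        ; syms = λ k → m+n≤o⇒m≤o _ (syms k)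
        ; covers = covers′
        }
        where
        open Invariant inv
        covers′ : ∀ j k → A j k ≡ true → ∃ λ i → Q i j ≡ just k
        covers′ j k demanded with covers j k demanded
        ... | inj₁ pending = contradiction (trans (sym (none j k)) pending) λ ()
        ... | inj₂ found   = found

      greedy : ∀ N {Q W} → Invariant Q W → sum (countF ∘ W) ≤ N → Completion s P A
      greedy N {W = W} inv total≤N with some-pending W
      ... | inj₂ none = finish inv none
      greedy zero    {W = W} inv total≤N | inj₁ (j , k , pending) =
        contradiction (subst (_≤ 0) (total-≔false W j k pending) total≤N) λ ()
      greedy (suc N) {W = W} inv total≤N | inj₁ (j , k , pending) =
        greedy N (proj₂ (serve inv pending)) (s≤s⁻¹ (subst (_≤ suc N) (total-≔false W j k pending) total≤N))

  greedy-completion : ∀ {m n} s → 3 * s < m → m ≤ n → (P : Array m n) → IsPLR P → (A : Demands n) →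
    (∀ j → colCount P j + countF (A j) ≤ s) → (∀ k → symCount P k + countF (λ j → A j k) ≤ s) →
    Completion s P A
  greedy-completion s 3s<m m≤n P isPLR A cols syms =
    Greedy.greedy s P A 3s<m m≤n _ initial ≤-refl
    where
    initial : Greedy.Invariant s P A P A
    initial = record
      { isPLR = isPLR ; extends = λ _ _ _ → id ; rows = λ _ → inj₁ ≤-refl
      ; cols = cols ; syms = syms ; covers = λ _ _ → inj₁ }

open import Data.Nat using (ℕ; zero; suc)
import Data.Nat as ℕ
import Data.Nat.Properties as ℕ
open import Data.Fin using (Fin; zero)
open import Data.Fin.Subset using (Subset; _∈_; ∣_∣)
open import Data.Vec using (lookup)
open import Data.Vec.Properties using ([]=⇒lookup)
open import Data.Maybe using (just)
open import Data.Product using (Σ; ∃; _×_; _,_)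
open import Data.Sum using (inj₁; inj₂; [_,_]′)
open import Data.Integer using (+_)
import Data.Integer as ℤ
import Data.Integer.Properties as ℤ
open import Data.Rational using (ℚ; 0ℚ; 1ℚ; _/_; _<_; _≤_; _*_; _+_; NonNegative; Positive; nonNegative; toℚᵘ; *≤*)
import Data.Rational.Properties as ℚ
open import Data.Rational.Solver using (module +-*-Solver)
import Data.Rational.Unnormalised as ℚᵘ
import Data.Rational.Unnormalised.Properties as ℚᵘ
open import Function using (_∘_; id)
open import Relation.Nullary using (yes; no; contradiction)
open import Relation.Binary.PropositionalEquality
open Counting using (∣p∣≡countF; maxF; f≤maxF; maxF-attained)
open Extension using (Completion; greedy-completion)

ℕ→ℚ-nonNeg : ∀ x → NonNegative (ℕ→ℚ x)
ℕ→ℚ-nonNeg x = ℚ.normalize-nonNeg x 1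

ℕ→ℚ-pos : ∀ x → Positive (ℕ→ℚ (suc x))
ℕ→ℚ-pos x = ℚ.normalize-pos (suc x) 1

0≤ℕ→ℚ : ∀ x → 0ℚ ≤ ℕ→ℚ x
0≤ℕ→ℚ x = ℚ.nonNegative⁻¹ (ℕ→ℚ x) {{ℕ→ℚ-nonNeg x}}

ℕ→ℚ-+ : ∀ x y → ℕ→ℚ (x ℕ.+ y) ≡ ℕ→ℚ x + ℕ→ℚ y
ℕ→ℚ-+ x y = ℚ.toℚᵘ-injective (begin
  toℚᵘ (ℕ→ℚ (x ℕ.+ y))                              ≈⟨ ℚ.toℚᵘ-fromℚᵘ (integer (x ℕ.+ y)) ⟩
  integer (x ℕ.+ y)                                  ≈⟨ ℚᵘ.*≡* (cong (ℤ._* + 1) (sym (cong₂ ℤ._+_ (ℤ.*-identityʳ (+ x)) (ℤ.*-identityʳ (+ y))))) ⟩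
  integer x ℚᵘ.+ integer y                           ≈⟨ ℚᵘ.+-cong (ℚ.toℚᵘ-fromℚᵘ (integer x)) (ℚ.toℚᵘ-fromℚᵘ (integer y)) ⟨
  toℚᵘ (ℕ→ℚ x) ℚᵘ.+ toℚᵘ (ℕ→ℚ y)                    ≈⟨ ℚ.toℚᵘ-homo-+ (ℕ→ℚ x) (ℕ→ℚ y) ⟨
  toℚᵘ (ℕ→ℚ x + ℕ→ℚ y)                              ∎)
  where
  open ℚᵘ.≃-Reasoning
  integer : ℕ → ℚᵘ.ℚᵘ
  integer z = ℚᵘ.mkℚᵘ (+ z) 0

ℕ→ℚ-* : ∀ x y → ℕ→ℚ (x ℕ.* y) ≡ ℕ→ℚ x * ℕ→ℚ y
ℕ→ℚ-* zero    y = sym (ℚ.*-zeroˡ (ℕ→ℚ y))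
ℕ→ℚ-* (suc x) y = begin
  ℕ→ℚ (y ℕ.+ x ℕ.* y)              ≡⟨ ℕ→ℚ-+ y (x ℕ.* y) ⟩
  ℕ→ℚ y + ℕ→ℚ (x ℕ.* y)            ≡⟨ cong₂ _+_ (ℚ.*-identityˡ (ℕ→ℚ y)) (sym (ℕ→ℚ-* x y)) ⟨
  1ℚ * ℕ→ℚ y + ℕ→ℚ x * ℕ→ℚ y       ≡⟨ ℚ.*-distribʳ-+ (ℕ→ℚ y) 1ℚ (ℕ→ℚ x) ⟨
  (1ℚ + ℕ→ℚ x) * ℕ→ℚ y             ≡⟨ cong (_* ℕ→ℚ y) (ℕ→ℚ-+ 1 x) ⟨
  ℕ→ℚ (suc x) * ℕ→ℚ y              ∎
  where open ≡-Reasoning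

ℕ→ℚ-mono-≤ : ∀ {x y} → x ℕ.≤ y → ℕ→ℚ x ≤ ℕ→ℚ y
ℕ→ℚ-mono-≤ {x} x≤y with ℕ.m≤n⇒∃[o]m+o≡n x≤y
... | d , refl = begin
  ℕ→ℚ x               ≡⟨ ℚ.+-identityʳ (ℕ→ℚ x) ⟨
  ℕ→ℚ x + 0ℚ          ≤⟨ ℚ.+-monoʳ-≤ (ℕ→ℚ x) (0≤ℕ→ℚ d) ⟩
  ℕ→ℚ x + ℕ→ℚ d       ≡⟨ ℕ→ℚ-+ x d ⟨
  ℕ→ℚ (x ℕ.+ d)       ∎
  where open ℚ.≤-Reasoning

ℕ→ℚ-cancel-< : ∀ {x y} → ℕ→ℚ x < ℕ→ℚ y → x ℕ.< y
ℕ→ℚ-cancel-< {x} {y} x<y with x ℕ.<? y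
... | yes x<ℕy = x<ℕy
... | no  x≮y  = contradiction (ℚ.<-≤-trans x<y (ℕ→ℚ-mono-≤ (ℕ.≮⇒≥ x≮y))) (ℚ.<-irrefl refl)

ℕ→ℚ-⊔-< : ∀ a b {q} → ℕ→ℚ a < q → ℕ→ℚ b < q → ℕ→ℚ (a ℕ.⊔ b) < q
ℕ→ℚ-⊔-< a b a<q b<q with ℕ.⊔-sel a b
... | inj₁ a⊔b≡a rewrite a⊔b≡a = a<q
... | inj₂ a⊔b≡b rewrite a⊔b≡b = b<q

bounded-max : ∀ {k q} (f : Fin (suc k) → ℕ) → (∀ x → ℕ→ℚ (f x) < q) → ∃ λ s → (∀ x → f x ℕ.≤ s) × ℕ→ℚ s < q
bounded-max {q = q} f f<q with maxF-attained f
... | x , attained = maxF f , f≤maxF f , subst (λ s → ℕ→ℚ s < q) (sym attained) (f<q x)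

ℕ→ℚ-+-< : ∀ a b {p q} → ℕ→ℚ a ≤ p → ℕ→ℚ b < q → ℕ→ℚ (a ℕ.+ b) < p + q
ℕ→ℚ-+-< a b a≤p b<q = subst (_< _) (sym (ℕ→ℚ-+ a b)) (ℚ.+-mono-≤-< a≤p b<q)

three-times-below : ∀ m {s c} → ℕ→ℚ s < c * ℕ→ℚ m → + 3 / 1 * c < 1ℚ → 3 ℕ.* s ℕ.< m
three-times-below m {s} {c} s<cm 3c<1 = ℕ→ℚ-cancel-< (begin-strict
  ℕ→ℚ (3 ℕ.* s)              ≡⟨ ℕ→ℚ-* 3 s ⟩
  + 3 / 1 * ℕ→ℚ s            <⟨ ℚ.*-monoʳ-<-pos (+ 3 / 1) s<cm ⟩
  + 3 / 1 * (c * ℕ→ℚ m)      ≡⟨ ℚ.*-assoc (+ 3 / 1) c (ℕ→ℚ m) ⟨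
  + 3 / 1 * c * ℕ→ℚ m        ≤⟨ ℚ.*-monoʳ-≤-nonNeg (ℕ→ℚ m) {{ℕ→ℚ-nonNeg m}} (ℚ.<⇒≤ 3c<1) ⟩
  1ℚ * ℕ→ℚ m                 ≡⟨ ℚ.*-identityˡ (ℕ→ℚ m) ⟩
  ℕ→ℚ m                      ∎)
  where open ℚ.≤-Reasoning

ℕ→ℚ-≤-rescale : ∀ m {x s c c′} → x ℕ.≤ s → ℕ→ℚ s < c * ℕ→ℚ m → c ≤ c′ → ℕ→ℚ x ≤ c′ * ℕ→ℚ m
ℕ→ℚ-≤-rescale m x≤s s<cm c≤c′ =
  ℚ.≤-trans (ℕ→ℚ-mono-≤ x≤s) (ℚ.≤-trans (ℚ.<⇒≤ s<cm) (ℚ.*-monoʳ-≤-nonNeg (ℕ→ℚ m) {{ℕ→ℚ-nonNeg m}} c≤c′))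

row-density : ∀ m n x s c → x ℕ.* suc m ℕ.≤ 3 ℕ.* s ℕ.* n → ℕ→ℚ s < c * ℕ→ℚ (suc m) →
  ℕ→ℚ x ≤ + 3 / 1 * c * ℕ→ℚ n
row-density m n x s c xm≤3sn s<cm = ℚ.*-cancelʳ-≤-pos M {{ℕ→ℚ-pos m}} (begin
  ℕ→ℚ x * M                       ≡⟨ ℕ→ℚ-* x (suc m) ⟨
  ℕ→ℚ (x ℕ.* suc m)               ≤⟨ ℕ→ℚ-mono-≤ xm≤3sn ⟩
  ℕ→ℚ (3 ℕ.* s ℕ.* n)             ≡⟨ trans (ℕ→ℚ-* (3 ℕ.* s) n) (cong (_* N) (ℕ→ℚ-* 3 s)) ⟩
  + 3 / 1 * ℕ→ℚ s * N             ≤⟨ ℚ.*-monoʳ-≤-nonNeg N {{ℕ→ℚ-nonNeg n}} (ℚ.*-monoˡ-≤-nonNeg (+ 3 / 1) (ℚ.<⇒≤ s<cm)) ⟩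
  + 3 / 1 * (c * M) * N           ≡⟨ solve 4 (λ a b c d → a :* (b :* c) :* d := a :* b :* d :* c) refl (+ 3 / 1) c M N ⟩
  + 3 / 1 * c * N * M             ∎)
  where
  open ℚ.≤-Reasoning
  open +-*-Solver
  M = ℕ→ℚ (suc m)
  N = ℕ→ℚ n

≤-three-times : ∀ {c} → 0ℚ ≤ c → c ≤ + 3 / 1 * c
≤-three-times {c} 0≤c = begin
  c               ≡⟨ ℚ.*-identityˡ c ⟨
  1ℚ * c          ≤⟨ ℚ.*-monoʳ-≤-nonNeg c {{nonNegative 0≤c}} {1ℚ} {+ 3 / 1} (*≤* (ℤ.+≤+ (ℕ.s≤s ℕ.z≤n))) ⟩
  + 3 / 1 * c     ∎
  where open ℚ.≤-Reasoning

capacity : ∀ m n {ε δ} (P : Array (suc m) (suc n)) (A : Fin (suc n) → Subset (suc n)) → Dense ε P →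
  (∀ j → ℕ→ℚ ∣ A j ∣ < δ * ℕ→ℚ (suc m)) → (∀ k → ℕ→ℚ (occurrences A k) < δ * ℕ→ℚ (suc m)) →
  ∃ λ s → (∀ j → colCount P j ℕ.+ ∣ A j ∣ ℕ.≤ s) × (∀ k → symCount P k ℕ.+ occurrences A k ℕ.≤ s) ×
    ℕ→ℚ s < (δ + ε) * ℕ→ℚ (suc m)
capacity m n {ε} {δ} P A (_ , colsP , symsP) |A|<δM occ<δM =
  let s , load≤s , s<cM = bounded-max load load<cM
  in s , (λ j → ℕ.≤-trans (ℕ.m≤m⊔n _ _) (load≤s j)) , (λ k → ℕ.≤-trans (ℕ.m≤n⊔m _ _) (load≤s k)) , s<cM
  where
  load : Fin (suc n) → ℕ
  load x = (colCount P x ℕ.+ ∣ A x ∣) ℕ.⊔ (symCount P x ℕ.+ occurrences A x)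
  εM+δM≤cM : ε * ℕ→ℚ (suc m) + δ * ℕ→ℚ (suc m) ≤ (δ + ε) * ℕ→ℚ (suc m)
  εM+δM≤cM = ℚ.≤-reflexive (trans (ℚ.+-comm (ε * ℕ→ℚ (suc m)) (δ * ℕ→ℚ (suc m))) (sym (ℚ.*-distribʳ-+ (ℕ→ℚ (suc m)) δ ε)))
  load<cM : ∀ x → ℕ→ℚ (load x) < (δ + ε) * ℕ→ℚ (suc m)
  load<cM x = ℕ→ℚ-⊔-< (colCount P x ℕ.+ ∣ A x ∣) (symCount P x ℕ.+ occurrences A x)
    (ℚ.<-≤-trans (ℕ→ℚ-+-< (colCount P x) ∣ A x ∣ (colsP x) (|A|<δM x)) εM+δM≤cM)
    (ℚ.<-≤-trans (ℕ→ℚ-+-< (symCount P x) (occurrences A x) (symsP x) (occ<δM x)) εM+δM≤cM)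

completion-dense : ∀ m n {ε c s} {P : Array (suc m) n} {A} → ℕ→ℚ s < c * ℕ→ℚ (suc m) → 0ℚ ≤ c → ε ≤ c →
  Dense ε P → (C : Completion s P A) → Dense (+ 3 / 1 * c) (Completion.array C)
completion-dense m n {ε} {c} {s} s<cM 0≤c ε≤c (rowsP , _) C = rows′ , cols′ , syms′
  where
  open Completion C
  c≤3c : c ≤ + 3 / 1 * c
  c≤3c = ≤-three-times 0≤c
  rows′ : ∀ i → ℕ→ℚ (rowCount array i) ≤ + 3 / 1 * c * ℕ→ℚ n
  rows′ i = [ (λ grown≤old → ℚ.≤-trans (ℕ→ℚ-mono-≤ grown≤old)
                               (ℚ.≤-trans (rowsP i) (ℚ.*-monoʳ-≤-nonNeg (ℕ→ℚ n) {{ℕ→ℚ-nonNeg n}} (ℚ.≤-trans ε≤c c≤3c))))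
            , (λ grown → row-density m n (rowCount array i) s c grown s<cM) ]′ (rows i)
  cols′ : ∀ j → ℕ→ℚ (colCount array j) ≤ + 3 / 1 * c * ℕ→ℚ (suc m)
  cols′ j = ℕ→ℚ-≤-rescale (suc m) (cols j) s<cM c≤3c
  syms′ : ∀ k → ℕ→ℚ (symCount array k) ≤ + 3 / 1 * c * ℕ→ℚ (suc m)
  syms′ k = ℕ→ℚ-≤-rescale (suc m) (syms k) s<cM c≤3c

dense-extension : ∀ m n {ε c} s (P : Array (suc m) (suc n)) (A : Fin (suc n) → Subset (suc n)) →
  suc m ℕ.≤ suc n → IsPLR P → Dense ε P → 0ℚ ≤ c → ε ≤ c → + 3 / 1 * c < 1ℚ →
  (∀ j → colCount P j ℕ.+ ∣ A j ∣ ℕ.≤ s) → (∀ k → symCount P k ℕ.+ occurrences A k ℕ.≤ s) →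
  ℕ→ℚ s < c * ℕ→ℚ (suc m) →
  Σ (Array (suc m) (suc n)) λ P′ → IsPLR P′ × Dense (+ 3 / 1 * c) P′ × P ⊑ P′ ×
    (∀ j k → k ∈ A j → ∃ λ i → P′ i j ≡ just k)
dense-extension m n {ε} {c} s P A m≤n isPLR dense 0≤c ε≤c 3c<1 col-load sym-load s<cm =
  array , isPLR′ , completion-dense m (suc n) {ε} {c} {s} s<cm 0≤c ε≤c dense C , extends ,
  λ j k k∈Aj → covers j k ([]=⇒lookup k∈Aj)
  where
  C : Completion s P (lookup ∘ A)
  C = greedy-completion s (three-times-below (suc m) {s} {c} s<cm 3c<1) m≤n P isPLR (lookup ∘ A)
        (λ j → subst (λ d → colCount P j ℕ.+ d ℕ.≤ s) (∣p∣≡countF (A j)) (col-load j)) sym-load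
  open Completion C renaming (isPLR to isPLR′)

lemma6p2 : (ε δ : ℚ) → 0ℚ < ε → ε < + 1 / 6 → 0ℚ < δ → δ < + 1 / 6 →
    (m n : ℕ) → m Data.Nat.≤ n →
    (P : Array m n) → IsPLR P → Dense ε P →
    (A : Fin n → Subset n) →
    (∀ j → ℕ→ℚ ∣ A j ∣ < δ * ℕ→ℚ m) →
    (∀ k → ℕ→ℚ (occurrences A k) < δ * ℕ→ℚ m) →
    Σ (Array m n) λ P′ → IsPLR P′ × Dense (+ 3 / 1 * (δ + ε)) P′ × P ⊑ P′ ×
      (∀ j k → k ∈ A j → ∃ λ i → P′ i j ≡ just k)
lemma6p2 ε δ _ _ _ _ zero zero _ P isPLR _ _ _ _ =
  P , isPLR , ((λ ()) , (λ ()) , (λ ())) , (λ _ _ _ → id) , (λ ())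
lemma6p2 ε δ _ _ _ _ zero (suc n) _ _ _ _ A |A|<δm _ =
  contradiction (ℚ.≤-<-trans (0≤ℕ→ℚ ∣ A zero ∣) (|A|<δm zero)) (ℚ.<-irrefl (sym (ℚ.*-zeroʳ δ)))
-- The rational parameters are passed explicitly (and no 'with' is used): letting Agda
-- infer them makes it normalise ℚ arithmetic on variables, which is prohibitively expensive.
lemma6p2 ε δ 0<ε ε<⅙ 0<δ δ<⅙ (suc m) (suc n) m≤n P isPLR dense A |A|<δm occ<δm =
  let s , col-load , sym-load , s<cm = capacity m n {ε} {δ} P A dense |A|<δm occ<δm
  in dense-extension m n {ε} {δ + ε} s P A m≤n isPLR dense 0≤c ε≤c 3c<1 col-load sym-load s<cm
  where
  0≤c : 0ℚ ≤ δ + ε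
  0≤c = ℚ.<⇒≤ (ℚ.+-mono-< 0<δ 0<ε)
  ε≤c : ε ≤ δ + ε
  ε≤c = subst (_≤ δ + ε) (ℚ.+-identityˡ ε) (ℚ.+-monoˡ-≤ ε (ℚ.<⇒≤ 0<δ))
  3c<1 : + 3 / 1 * (δ + ε) < 1ℚ
  3c<1 = ℚ.*-monoʳ-<-pos (+ 3 / 1) (ℚ.+-mono-< δ<⅙ ε<⅙)
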